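{- Fix any Outcome Logic instance (execution model, program states $\Sigma$ with atomic command semantics, and atomic assertions with satisfaction relation). For any program $C$ and any outcome assertions $\varphi,\varphi',\psi$: if $\varphi'\Rightarrow\varphi$, $\mathsf{sat}(\varphi')$, and $\vDash\langle\varphi'\rangle C\langle\lnot\psi\rangle$, then $\not\vDash\langle\varphi\rangle C\langle\psi\rangle$.
   Context: An execution model $\langle M,\mathsf{bind},\mathsf{unit},\diamond,\varnothing\rangle$ is a monad on sets such that each $\langle MA,\diamond,\varnothing\rangle$ is a partial commutative monoid with $\mathsf{bind}(m_1\diamond m_2,k)=\mathsf{bind}(m_1,k)\diamond\mathsf{bind}(m_2,k)$ and $\mathsf{bind}(\varnothing,k)=\varnothing$; $f^\dagger(m)=\mathsf{bind}(m,f)$. Programs $C::=\mathbf 0\mid\mathbf 1\mid C_1;C_2\mid C_1+C_2\mid C^\star\mid c$ have denotations $[\![C]\!]:\Sigma\to M\Sigma$: $[\![\mathbf 0]\!](\sigma)=\varnothing$, $[\![\mathbf 1]\!](\sigma)=\mathsf{unit}(\sigma)$, $[\![C_1;C_2]\!](\sigma)=\mathsf{bind}([\![C_1]\!](\sigma),[\![C_2]\!])$, $[\![C_1+C_2]\!](\sigma)=[\![C_1]\!](\sigma)\diamond[\![C_2]\!](\sigma)$, $[\![C^\star]\!]=\mathrm{lfp}(\lambda f.\lambda\sigma.f^\dagger([\![C]\!](\sigma))\diamond\mathsf{unit}(\sigma))$, and $[\![c]\!]$ given for atomic commands. Outcome assertions over atomic assertions $\mathsf{Prop}$ (with relation $\vDash_{\mathsf{atom}}\subseteq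 M\Sigma\times\mathsf{Prop}$): $\varphi::=\top\mid\bot\mid\top^\oplus\mid\varphi\land\psi\mid\varphi\oplus\psi\mid\varphi\Rightarrow\psi\mid P$, with $m\vDash\top$ always, $m\vDash\bot$ never, $m\vDash\top^\oplus$ iff $m=\varnothing$, $\land$ as usual, $m\vDash\varphi\oplus\psi$ iff $m=m_1\diamond m_2$ (defined) with $m_1\vDash\varphi$, $m_2\vDash\psi$; $m\vDash\varphi\Rightarrow\psi$ iff $m\vDash\varphi$ implies $m\vDash\psi$; $m\vDash P$ iff $m\vDash_{\mathsf{atom}}P$. $\lnot\psi:=\psi\Rightarrow\bot$. The statement $\varphi'\Rightarrow\varphi$ means every $m$ satisfying $\varphi'$ satisfies $\varphi$; $\mathsf{sat}(\varphi')$ means some $m$ satisfies $\varphi'$. $\vDash\langle\varphi\rangle C\langle\psi\rangle$ iff for all $m\in M\Sigma$, $m\vDash\varphi$ implies $[\![C]\!]^\dagger(m)\vDash\psi$. -}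

module Defs where

open import Level using (0ℓ)
open import Data.Maybe using (Maybe; just; nothing)
open import Data.Product using (Σ; ∃; ∃-syntax; _×_; _,_)
open import Data.Empty using (⊥)
open import Data.Unit using (⊤)
open import Relation.Binary.PropositionalEquality using (_≡_)

record ExecutionModel : Set₁ where
  field
    M    : Set → Set
    unit : ∀ {A} → A → M A
    bind : ∀ {A B} → M A → (A → M B) → M B
    bind-unitˡ : ∀ {A B} (a : A) (k : A → M B) → bind (unit a) k ≡ k a
    bind-unitʳ : ∀ {A} (m : M A) → bind m unit ≡ m
    bind-assoc : ∀ {A B C} (m : M A) (f : A → M B) (g : B → M C) →
                 bind (bind m f) g ≡ bind m (λ a → bind (f a) g)
    _⋄_  : ∀ {A} → M A → M A → Maybe (M A)
    ∅    : ∀ {A} → M A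
    ⋄-comm  : ∀ {A} (m₁ m₂ : M A) → m₁ ⋄ m₂ ≡ m₂ ⋄ m₁
    ⋄-identity : ∀ {A} (m : M A) → m ⋄ ∅ ≡ just m
    ⋄-assoc : ∀ {A} (m₁ m₂ m₃ m₁₂ m : M A) → m₁ ⋄ m₂ ≡ just m₁₂ → m₁₂ ⋄ m₃ ≡ just m →
              ∃[ m₂₃ ] (m₂ ⋄ m₃ ≡ just m₂₃ × m₁ ⋄ m₂₃ ≡ just m)
    ⋄-assoc′ : ∀ {A} (m₁ m₂ m₃ m₂₃ m : M A) → m₂ ⋄ m₃ ≡ just m₂₃ → m₁ ⋄ m₂₃ ≡ just m →
              ∃[ m₁₂ ] (m₁ ⋄ m₂ ≡ just m₁₂ × m₁₂ ⋄ m₃ ≡ just m)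
    bind-⋄ : ∀ {A B} (m₁ m₂ m : M A) (k : A → M B) → m₁ ⋄ m₂ ≡ just m →
             bind m₁ k ⋄ bind m₂ k ≡ just (bind m k)
    bind-∅ : ∀ {A B} (k : A → M B) → bind ∅ k ≡ ∅

  _† : ∀ {A B} → (A → M B) → M A → M B
  (f †) m = bind m f

data Cmd (Atom : Set) : Set where
  𝟘 𝟙   : Cmd Atom
  _⨾_   : Cmd Atom → Cmd Atom → Cmd Atom
  _⊕ᶜ_  : Cmd Atom → Cmd Atom → Cmd Atom
  _⋆    : Cmd Atom → Cmd Atom
  atom  : Atom → Cmd Atom

-- Since ⋄ is partial and lfp needs an order, the denotation is given
-- as part of the instance together with the equations defining it.

record OLInstance : Set₁ where
  field
    EM    : ExecutionModel
  open ExecutionModel EM public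
  field
    State  : Set
    Atom   : Set
    atomSem : Atom → State → M State
    Prop   : Set
    _⊨atom_ : M State → Prop → Set
    _⊑_    : M State → M State → Set
    ⊑-refl  : ∀ m → m ⊑ m
    ⊑-trans : ∀ {m₁ m₂ m₃} → m₁ ⊑ m₂ → m₂ ⊑ m₃ → m₁ ⊑ m₃
    ⊑-antisym : ∀ {m₁ m₂} → m₁ ⊑ m₂ → m₂ ⊑ m₁ → m₁ ≡ m₂
    ⟦_⟧ : Cmd Atom → State → M State
    ⟦𝟘⟧ : ∀ σ → ⟦ 𝟘 ⟧ σ ≡ ∅
    ⟦𝟙⟧ : ∀ σ → ⟦ 𝟙 ⟧ σ ≡ unit σ
    ⟦⨾⟧ : ∀ C₁ C₂ σ → ⟦ C₁ ⨾ C₂ ⟧ σ ≡ bind (⟦ C₁ ⟧ σ) ⟦ C₂ ⟧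
    ⟦⊕⟧ : ∀ C₁ C₂ σ → ⟦ C₁ ⟧ σ ⋄ ⟦ C₂ ⟧ σ ≡ just (⟦ C₁ ⊕ᶜ C₂ ⟧ σ)
    ⟦atom⟧ : ∀ c σ → ⟦ atom c ⟧ σ ≡ atomSem c σ
    ⟦⋆⟧-fix : ∀ C σ → bind (⟦ C ⟧ σ) ⟦ C ⋆ ⟧ ⋄ unit σ ≡ just (⟦ C ⋆ ⟧ σ)
    ⟦⋆⟧-least : ∀ C (f : State → M State) →
                (∀ σ → bind (⟦ C ⟧ σ) f ⋄ unit σ ≡ just (f σ)) →
                ∀ σ → ⟦ C ⋆ ⟧ σ ⊑ f σ

data Assn (Prop : Set) : Set where
  ⊤ᵃ ⊥ᵃ ⊤⊕ : Assn Prop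
  _∧ᵃ_ _⊕ᵃ_ _⇒ᵃ_ : Assn Prop → Assn Prop → Assn Prop
  atomᵃ : Prop → Assn Prop

¬ᵃ_ : ∀ {Prop} → Assn Prop → Assn Prop
¬ᵃ ψ = ψ ⇒ᵃ ⊥ᵃ

module OL (I : OLInstance) where
  open OLInstance I

  infix 4 _⊨_
  _⊨_ : M State → Assn Prop → Set
  m ⊨ ⊤ᵃ = ⊤
  m ⊨ ⊥ᵃ = ⊥
  m ⊨ ⊤⊕ = m ≡ ∅
  m ⊨ (φ ∧ᵃ ψ) = (m ⊨ φ) × (m ⊨ ψ)
  m ⊨ (φ ⊕ᵃ ψ) = ∃[ m₁ ] ∃[ m₂ ] (m₁ ⋄ m₂ ≡ just m × m₁ ⊨ φ × m₂ ⊨ ψ)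
  m ⊨ (φ ⇒ᵃ ψ) = m ⊨ φ → m ⊨ ψ
  m ⊨ atomᵃ P = m ⊨atom P

  Entails : Assn Prop → Assn Prop → Set
  Entails φ' φ = ∀ m → m ⊨ φ' → m ⊨ φ

  sat : Assn Prop → Set
  sat φ = ∃[ m ] (m ⊨ φ)

  Triple : Assn Prop → Cmd Atom → Assn Prop → Set
  Triple φ C ψ = ∀ m → m ⊨ φ → (⟦ C ⟧ †) m ⊨ ψ

module Submission where

open import Defs
open import Relation.Nullary using (¬_)
open import Data.Product using (_,_)

module _ (I : OLInstance) where
  open OLInstance I using (Atom; Prop)
  open OL I

  Triple-strengthenˡ : ∀ φ φ′ C ψ → Entails φ′ φ → Triple φ C ψ → Triple φ′ C ψ
  Triple-strengthenˡ φ φ′ C ψ φ′⇒φ ⟨φ⟩C⟨ψ⟩ m m⊨φ′ = ⟨φ⟩C⟨ψ⟩ m (φ′⇒φ m m⊨φ′)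

  Triple-¬-incompatible : ∀ φ C ψ → sat φ → Triple φ C (¬ᵃ ψ) → ¬ Triple φ C ψ
  Triple-¬-incompatible φ C ψ (m , m⊨φ) ⟨φ⟩C⟨¬ψ⟩ ⟨φ⟩C⟨ψ⟩ =
    ⟨φ⟩C⟨¬ψ⟩ m m⊨φ (⟨φ⟩C⟨ψ⟩ m m⊨φ)

theorem5p2 : (I : OLInstance) (C : Cmd (OLInstance.Atom I))
    (φ φ′ ψ : Assn (OLInstance.Prop I)) →
    OL.Entails I φ′ φ → OL.sat I φ′ → OL.Triple I φ′ C (¬ᵃ ψ) →
    ¬ OL.Triple I φ C ψ
theorem5p2 I C φ φ′ ψ φ′⇒φ sat-φ′ ⟨φ′⟩C⟨¬ψ⟩ ⟨φ⟩C⟨ψ⟩ =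
  Triple-¬-incompatible I φ′ C ψ sat-φ′ ⟨φ′⟩C⟨¬ψ⟩
    (Triple-strengthenˡ I φ φ′ C ψ φ′⇒φ ⟨φ⟩C⟨ψ⟩)
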